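{- Let $G$ be a connected graph and let $G'$ be obtained from $G$ by adding a new vertex adjacent to exactly one vertex of $G$ (attaching a leaf). Then $\operatorname{cdim}(G')=\operatorname{cdim}(G)+1$ if $G$ forces a $\mathbb{1}$ representation, and $\operatorname{cdim}(G')=\operatorname{cdim}(G)$ otherwise. In particular, $\operatorname{cdim}(G')$ does not depend on the vertex of $G$ to which the leaf is attached.
   Context: All graphs are nonempty, finite, simple and undirected. For distinct vertices $v,w$ of a graph $G$, $\kappa_G(v,w)$ denotes the maximum number of internally vertex-disjoint $v$–$w$ paths in $G$; by convention $\kappa_G(v,v)=\infty$. For an ordered vertex set $W=\{w_1,\ldots,w_k\}\subseteq V(G)$, the connectivity representation of $v$ is $r_G(v,W)=[\kappa_G(v,w_1),\ldots,\kappa_G(v,w_k)]$. $W$ is resolving for $G$ if $r_G(v_1,W)=r_G(v_2,W)$ implies $v_1=v_2$ for all $v_1,v_2\in V(G)$. A (connectivity) basis is a resolving set of minimum cardinality, and $\operatorname{cdim}(G)$ is its cardinality. A graph $G$ forces a $\mathbb{1}$ representation if for every basis $B$ of $G$ there is a vertex $v\in V(G)$ with $r_G(v,B)=\mathbb{1}=[1,\ldots,1]$, the all-ones vector of length $|B|$ (for $B=\emptyset$ the empty vector). -}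

module Defs where

open import Data.Nat using (ℕ; zero; suc; _≤_)
open import Data.Fin using (Fin; zero; suc; _≟_)
open import Data.Bool using (Bool; true; false)
open import Data.List using (List; []; _∷_; length)
open import Data.List.Membership.Propositional using (_∈_)
open import Data.List.Relation.Unary.All using (All)
open import Data.List.Relation.Unary.AllPairs using (AllPairs)
open import Data.List.Relation.Unary.Unique.Propositional using (Unique)
open import Data.Product using (Σ; ∃; _×_; _,_)
open import Data.Sum using (_⊎_)
open import Relation.Nullary using (¬_; yes; no)
open import Relation.Nullary.Decidable using (⌊_⌋)
open import Relation.Binary.PropositionalEquality using (_≡_; refl)
open import Function.Definitions using (Injective)

record Graph (n : ℕ) : Set where
  field
    adj   : Fin n → Fin n → Bool
    adj-sym : ∀ x y → adj x y ≡ adj y x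
    irref : ∀ x → adj x x ≡ false
open Graph public

module _ {n : ℕ} (G : Graph n) where

  data Chain : Fin n → Fin n → List (Fin n) → Set where
    single : ∀ v → Chain v v (v ∷ [])
    step   : ∀ {v x w p} → adj G v x ≡ true → Chain x w p → Chain v w (v ∷ p)

  IsPath : Fin n → Fin n → List (Fin n) → Set
  IsPath v w p = Chain v w p × Unique p

  Connected : Set
  Connected = ∀ v w → ∃ λ p → IsPath v w p

  IntDisjoint : Fin n → Fin n → List (Fin n) → List (Fin n) → Set
  IntDisjoint v w p q = (¬ p ≡ q) × (∀ x → x ∈ p → x ∈ q → (x ≡ v) ⊎ (x ≡ w))

  DisjointFamily : Fin n → Fin n → ℕ → Set
  DisjointFamily v w k =
    Σ (List (List (Fin n))) λ ps →
      (length ps ≡ k) × All (IsPath v w) ps × AllPairs (IntDisjoint v w) ps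

  IsKappa : Fin n → Fin n → ℕ → Set
  IsKappa v w k = (¬ v ≡ w) × DisjointFamily v w k × (∀ m → DisjointFamily v w m → m ≤ k)

data ℕ∞ : Set where
  fin : ℕ → ℕ∞
  ∞   : ℕ∞

data KappaIs {n : ℕ} (G : Graph n) (v w : Fin n) : ℕ∞ → Set where
  κ∞   : v ≡ w → KappaIs G v w ∞
  κfin : ∀ {k} → IsKappa G v w k → KappaIs G v w (fin k)

module _ {n : ℕ} (G : Graph n) where

  -- r_G(v1,W) = r_G(v2,W) for an ordered vertex set W = (W 0, …, W (k-1)).
  SameRep : ∀ {k} → (Fin k → Fin n) → Fin n → Fin n → Set
  SameRep W v₁ v₂ = ∀ i → ∃ λ x → KappaIs G v₁ (W i) x × KappaIs G v₂ (W i) x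

  Resolving : ∀ {k} → (Fin k → Fin n) → Set
  Resolving W = ∀ v₁ v₂ → SameRep W v₁ v₂ → v₁ ≡ v₂

  IsBasis : ∀ {k} → (Fin k → Fin n) → Set
  IsBasis {k} B = Injective _≡_ _≡_ B × Resolving B ×
    (∀ m (W : Fin m → Fin n) → Injective _≡_ _≡_ W → Resolving W → k ≤ m)

  IsCdim : ℕ → Set
  IsCdim d = Σ (Fin d → Fin n) IsBasis

  Forces𝟙 : Set
  Forces𝟙 = ∀ k (B : Fin k → Fin n) → IsBasis B →
    ∃ λ v → ∀ i → KappaIs G v (B i) (fin 1)

-- G' : attach a new leaf (vertex zero) to vertex u of G; old vertex x becomes suc x.
addLeaf : ∀ {n} → Graph n → Fin n → Graph (suc n)
addLeaf {n} G u = record { adj = a ; adj-sym = s ; irref = i }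
  where
  a : Fin (suc n) → Fin (suc n) → Bool
  a zero    zero    = false
  a zero    (suc y) = ⌊ y ≟ u ⌋
  a (suc x) zero    = ⌊ x ≟ u ⌋
  a (suc x) (suc y) = adj G x y
  s : ∀ x y → a x y ≡ a y x
  s zero    zero    = refl
  s zero    (suc y) = refl
  s (suc x) zero    = refl
  s (suc x) (suc y) = adj-sym G x y
  i : ∀ x → a x x ≡ false
  i zero    = refl
  i (suc x) = irref G x

{-# OPTIONS --safe #-}
module Submission where

-- Paths between old vertices never visit the leaf ℓ (it could only be entered and left through its
-- neighbour u), so κ is unchanged on G, while κ(ℓ, x) = 1 for every old x. Hence a set V of old
-- vertices resolves G′ iff it resolves G and no vertex has representation 𝟙 with respect to V (such a
-- vertex would be confused with ℓ), ℓ together with any resolving set of G resolves G′, and deleting ℓ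
-- from a resolving set of G′ leaves a resolving set of G. So cdim(G′) = cdim(G) exactly when some basis
-- of G admits no 𝟙 representation. Finding that basis constructively needs κ to be computable, which it
-- is by exhaustive search over the finitely many paths.

open import Defs
open import Data.Bool using (true; T)
import Data.Bool.Properties as Boolₚ
open import Data.Empty using (⊥-elim)
open import Data.Fin using (Fin; zero; suc; _≟_; punchIn; punchOut; finToFun; funToFin)
open import Data.Fin.Properties
  using ( suc-injective; injective⇒≤; finToFun-funToFin
        ; punchIn-injective; punchInᵢ≢i; punchIn-punchOut; punchOut-injective)
import Data.Fin.Properties as Finₚ
open import Data.List
  using (List; []; _∷_; [_]; _∷ʳ_; length; lookup; map; reverse; allFin; cartesianProductWith)
open import Data.List.Properties using (≡-dec; length-map; map-injective; unfold-reverse; reverse-injective)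
open import Data.List.Membership.Propositional using (_∈_; find; lose)
open import Data.List.Membership.Propositional.Properties
  using (∈-allFin; ∈-cartesianProductWith⁺; ∈-lookup; ∈-map⁺; ∈-map⁻)
open import Data.List.Membership.Setoid.Properties using (index-injective)
import Data.List.Membership.DecPropositional as DecMembership
open import Data.List.Relation.Unary.Any using (here; there; index; any?)
open import Data.List.Relation.Unary.Any.Properties using (reverse⁻)
open import Data.List.Relation.Unary.All as All using (All; []; _∷_)
import Data.List.Relation.Unary.All.Properties as Allₚ
open import Data.List.Relation.Unary.AllPairs as AllPairs using ([]; _∷_)
import Data.List.Relation.Unary.AllPairs.Properties as AllPairsₚ
open import Data.List.Relation.Unary.Unique.Propositional using (Unique)
import Data.List.Relation.Unary.Unique.Propositional.Properties as Uniqueₚ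
import Data.List.Relation.Unary.Unique.DecPropositional as DecUnique
open import Data.List.Relation.Binary.Permutation.Propositional using (↭-sym; ↭⇒↭ₛ)
open import Data.List.Relation.Binary.Permutation.Propositional.Properties using (↭-reverse)
import Data.List.Relation.Binary.Permutation.Setoid.Properties as PermutationSetoidₚ
open import Data.Nat using (ℕ; zero; suc; _≤_; z≤n; s≤s)
open import Data.Nat.Properties as ℕₚ
  using (≤-reflexive; ≤-pred; ≤-antisym; ≤∧≢⇒<; m≤n⇒m≤1+n; m≤n⇒m<n∨m≡n)
open import Data.Product using (Σ; ∃; _×_; _,_; proj₁)
open import Data.Sum as Sum using (_⊎_; inj₁; inj₂)
open import Data.Unit using (tt)
open import Function using (_∘_; case_of_)
open import Function.Definitions using (Injective)
open import Relation.Binary.Definitions using (DecidableEquality)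
open import Relation.Binary.PropositionalEquality using (_≡_; _≢_; refl; sym; trans; cong; subst; setoid)
open import Relation.Nullary using (¬_; Dec; yes; no; contradiction; map′; ¬?)
open import Relation.Nullary.Decidable
  using (⌊_⌋; _×-dec_; _⊎-dec_; _→-dec_; toWitness; dec-true; isYes≗does)
open import Relation.Unary using (Decidable)

module _ {A : Set} where

  boundedLists : List A → ℕ → List (List A)
  boundedLists E zero    = [ [] ]
  boundedLists E (suc k) = [] ∷ cartesianProductWith _∷_ E (boundedLists E k)

  ∈-boundedLists : ∀ {E k xs} → length xs ≤ k → All (_∈ E) xs → xs ∈ boundedLists E k
  ∈-boundedLists {k = zero}  {[]}    _         _          = here refl
  ∈-boundedLists {k = suc k} {[]}    _         _          = here refl
  ∈-boundedLists {k = suc k} {x ∷ xs} (s≤s len) (x∈E ∷ xs⊆E) =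
    there (∈-cartesianProductWith⁺ _∷_ x∈E (∈-boundedLists len xs⊆E))

  Unique-lookup-injective : ∀ {xs : List A} → Unique xs → ∀ i j → lookup xs i ≡ lookup xs j → i ≡ j
  Unique-lookup-injective (_    ∷ _)   zero    zero    _  = refl
  Unique-lookup-injective (x∉xs ∷ _)   zero    (suc j) eq =
    contradiction eq (All.lookup x∉xs (∈-lookup j))
  Unique-lookup-injective (x∉xs ∷ _)   (suc i) zero    eq =
    contradiction (sym eq) (All.lookup x∉xs (∈-lookup i))
  Unique-lookup-injective (_    ∷ xs!) (suc i) (suc j) eq =
    cong suc (Unique-lookup-injective xs! i j eq)

  Unique⇒length≤ : ∀ {xs E : List A} → Unique xs → All (_∈ E) xs → length xs ≤ length E
  Unique⇒length≤ {xs} {E} xs! xs⊆E = injective⇒≤ {f = position} λ {i} {j} eq →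
    Unique-lookup-injective xs! i j (index-injective (setoid A) (lookup-∈E i) (lookup-∈E j) eq)
    where
    lookup-∈E : ∀ i → lookup xs i ∈ E
    lookup-∈E i = All.lookup xs⊆E (∈-lookup i)
    position : Fin (length xs) → Fin (length E)
    position i = index (lookup-∈E i)

  Unique-reverse : ∀ {xs : List A} → Unique xs → Unique (reverse xs)
  Unique-reverse {xs} = PermutationSetoidₚ.Unique-resp-↭ (setoid A) (↭⇒↭ₛ (↭-sym (↭-reverse xs)))

  ∃?-enumerated : ∀ {P : A → Set} (L : List A) → (∀ {x} → P x → x ∈ L) → Decidable P → Dec (∃ P)
  ∃?-enumerated L complete P? = map′ (λ any → let x , _ , px = find any in x , px)
                                     (λ (x , px) → lose (complete px) px) (any? P? L)

∃?-function : ∀ {d N} (P : (Fin d → Fin N) → Set) → (∀ {f g} → (∀ i → f i ≡ g i) → P f → P g) →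
              Decidable P → Dec (∃ P)
∃?-function P resp P? = map′ (λ (k , p) → finToFun k , p)
                             (λ (f , p) → funToFin f , resp (sym ∘ finToFun-funToFin f) p)
                             (Finₚ.any? (P? ∘ finToFun))

greatest : ∀ {P : ℕ → Set} → Decidable P → P 0 → ∀ M → (∀ m → P m → m ≤ M) →
           ∃ λ k → P k × (∀ m → P m → m ≤ k)
greatest P? p0 zero    bound = 0 , p0 , bound
greatest P? p0 (suc M) bound with P? (suc M)
... | yes p = suc M , p , bound
... | no ¬p = greatest P? p0 M λ m pm → ≤-pred (≤∧≢⇒< (bound m pm) λ { refl → ¬p pm })

_≟∞_ : DecidableEquality ℕ∞
fin a ≟∞ fin b = map′ (cong fin) (λ { refl → refl }) (a ℕₚ.≟ b)
fin _ ≟∞ ∞     = no λ ()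
∞     ≟∞ fin _ = no λ ()
∞     ≟∞ ∞     = yes refl

module Paths {N : ℕ} (G : Graph N) where

  open DecMembership (_≟_ {N}) using (_∈?_)
  open DecUnique (_≟_ {N}) using (unique?)

  chain-head : ∀ {v w a p} → Chain G v w (a ∷ p) → v ≡ a
  chain-head (single _) = refl
  chain-head (step _ _) = refl

  chain-first : ∀ {v w p} → Chain G v w p → v ∈ p
  chain-first (single _) = here refl
  chain-first (step _ _) = here refl

  chain-last : ∀ {v w p} → Chain G v w p → w ∈ p
  chain-last (single _) = here refl
  chain-last (step _ c) = there (chain-last c)

  step⁻¹ : ∀ {v w a b p} → Chain G v w (a ∷ b ∷ p) → a ≡ v × adj G v b ≡ true × Chain G b w (b ∷ p)
  step⁻¹ (step e c) with refl ← chain-head c = refl , e , c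

  chain? : ∀ v w p → Dec (Chain G v w p)
  chain? v w []          = no λ ()
  chain? v w (a ∷ [])    = map′ (λ { (refl , refl) → single v })
                                (λ { (single _) → refl , refl ; (step _ ()) })
                                ((a ≟ v) ×-dec (v ≟ w))
  chain? v w (a ∷ b ∷ p) = map′ (λ { (refl , e , c) → step e c }) step⁻¹
                                ((a ≟ v) ×-dec (adj G v b Boolₚ.≟ true) ×-dec chain? b w (b ∷ p))

  path? : ∀ v w p → Dec (IsPath G v w p)
  path? v w p = chain? v w p ×-dec unique? p

  intDisjoint? : ∀ v w p q → Dec (IntDisjoint G v w p q)
  intDisjoint? v w p q = ¬? (≡-dec _≟_ p q) ×-dec
    map′ (λ shared x → All.lookup shared) (λ shared → All.tabulate (shared _))
         (All.all? (λ x → (x ∈? q) →-dec ((x ≟ v) ⊎-dec (x ≟ w))) p)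

  paths : List (List (Fin N))
  paths = boundedLists (allFin N) (length (allFin N))

  ∈-paths : ∀ {v w p} → IsPath G v w p → p ∈ paths
  ∈-paths (_ , p!) = ∈-boundedLists (Unique⇒length≤ p! (everywhere _)) (everywhere _)
    where
    everywhere : ∀ xs → All (_∈ allFin N) xs
    everywhere xs = All.tabulate λ {x} _ → ∈-allFin x

  disjointFamily? : ∀ v w m → Dec (DisjointFamily G v w m)
  disjointFamily? v w m =
    ∃?-enumerated (boundedLists paths m)
      (λ (len , ps , _) → ∈-boundedLists (≤-reflexive len) (All.map ∈-paths ps))
      (λ ps → (length ps ℕₚ.≟ m) ×-dec All.all? (path? v w) ps
                                  ×-dec AllPairs.allPairs? (intDisjoint? v w) ps)

  family-size≤ : ∀ {v w m} → DisjointFamily G v w m → m ≤ length paths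
  family-size≤ (ps , refl , ps-paths , disjoint) =
    Unique⇒length≤ (AllPairs.map proj₁ disjoint) (All.map ∈-paths ps-paths)

  kappa : ∀ v w → ∃ (KappaIs G v w)
  kappa v w with v ≟ w
  ... | yes v≡w = ∞ , κ∞ v≡w
  ... | no v≢w  = let k , family , maximal = greatest (disjointFamily? v w) ([] , refl , [] , [])
                                                      (length paths) (λ _ → family-size≤)
                  in fin k , κfin (v≢w , family , maximal)

  KappaIs-functional : ∀ {v w x y} → KappaIs G v w x → KappaIs G v w y → x ≡ y
  KappaIs-functional (κ∞ _)                   (κ∞ _)                   = refl
  KappaIs-functional (κ∞ v≡w)                 (κfin (v≢w , _))         = contradiction v≡w v≢w
  KappaIs-functional (κfin (v≢w , _))         (κ∞ v≡w)                 = contradiction v≡w v≢w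
  KappaIs-functional (κfin (_ , fam₁ , max₁)) (κfin (_ , fam₂ , max₂)) =
    cong fin (≤-antisym (max₂ _ fam₁) (max₁ _ fam₂))

  kappaIs? : ∀ v w x → Dec (KappaIs G v w x)
  kappaIs? v w x = let y , κ = kappa v w in map′ (λ { refl → κ }) (KappaIs-functional κ) (y ≟∞ x)

  chain-∷ʳ : ∀ {v w z p} → Chain G v w p → adj G w z ≡ true → Chain G v z (p ∷ʳ z)
  chain-∷ʳ (single _) e = step e (single _)
  chain-∷ʳ (step e′ c) e = step e′ (chain-∷ʳ c e)

  chain-reverse : ∀ {v w p} → Chain G v w p → Chain G w v (reverse p)
  chain-reverse (single v) = single v
  chain-reverse {v} (step {x = x} {p = p} e c) =
    subst (Chain G _ v) (sym (unfold-reverse v p))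
          (chain-∷ʳ (chain-reverse c) (trans (adj-sym G x v) e))

  path-reverse : ∀ {v w p} → IsPath G v w p → IsPath G w v (reverse p)
  path-reverse (c , p!) = chain-reverse c , Unique-reverse p!

  intDisjoint-reverse : ∀ {v w p q} → IntDisjoint G v w p q → IntDisjoint G w v (reverse p) (reverse q)
  intDisjoint-reverse (p≢q , shared) =
    p≢q ∘ reverse-injective , λ x x∈p x∈q → Sum.swap (shared x (reverse⁻ x∈p) (reverse⁻ x∈q))

  family-reverse : ∀ {v w m} → DisjointFamily G v w m → DisjointFamily G w v m
  family-reverse (ps , len , ps-paths , disjoint) =
    map reverse ps , trans (length-map reverse ps) len ,
    Allₚ.map⁺ (All.map path-reverse ps-paths) ,
    AllPairsₚ.map⁺ (AllPairs.map intDisjoint-reverse disjoint)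

  kappa-sym : ∀ {v w x} → KappaIs G v w x → KappaIs G w v x
  kappa-sym (κ∞ v≡w) = κ∞ (sym v≡w)
  kappa-sym (κfin (v≢w , family , maximal)) =
    κfin (v≢w ∘ sym , family-reverse family , λ m → maximal m ∘ family-reverse)

  loop-trivial : ∀ {v p} → IsPath G v v p → p ≡ [ v ]
  loop-trivial (single _ , _)       = refl
  loop-trivial (step _ c , v∉p ∷ _) = contradiction refl (All.lookup v∉p (chain-last c))

_⊆_ : ∀ {k m N} → (Fin k → Fin N) → (Fin m → Fin N) → Set
W ⊆ W′ = ∀ i → ∃ λ j → W i ≡ W′ j

module Representations {N : ℕ} (G : Graph N) where

  open Paths G

  Rep𝟙 : ∀ {k} → (Fin k → Fin N) → Fin N → Set
  Rep𝟙 W v = ∀ i → KappaIs G v (W i) (fin 1)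

  ResolvingLowerBound : ℕ → Set
  ResolvingLowerBound d = ∀ m (W : Fin m → Fin N) → Injective _≡_ _≡_ W → Resolving G W → d ≤ m

  sameRep-sym : ∀ {k} {W : Fin k → Fin N} {v w} → SameRep G W v w → SameRep G W w v
  sameRep-sym s i = let x , κv , κw = s i in x , κw , κv

  sameRep-⊆ : ∀ {k m} {W : Fin k → Fin N} {W′ : Fin m → Fin N} {v w} →
              W ⊆ W′ → SameRep G W′ v w → SameRep G W v w
  sameRep-⊆ {v = v} {w} W⊆W′ s i = let j , Wi≡W′j = W⊆W′ i in
    subst (λ x → ∃ λ y → KappaIs G v x y × KappaIs G w x y) (sym Wi≡W′j) (s j)

  resolving-⊆ : ∀ {k m} {W : Fin k → Fin N} {W′ : Fin m → Fin N} →
                W ⊆ W′ → Resolving G W → Resolving G W′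
  resolving-⊆ W⊆W′ res v w = res v w ∘ sameRep-⊆ W⊆W′

  sameRep-member : ∀ {k} {W : Fin k → Fin N} {w} i → SameRep G W (W i) w → W i ≡ w
  sameRep-member i s with s i
  ... | ∞     , _                , κ∞ w≡Wi = sym w≡Wi
  ... | fin _ , κfin (Wi≢Wi , _) , _       = contradiction refl Wi≢Wi

  sameRep-rep𝟙 : ∀ {k} {W : Fin k → Fin N} {v w} → SameRep G W v w → Rep𝟙 W v → Rep𝟙 W w
  sameRep-rep𝟙 s r i with x , κv , κw ← s i with refl ← KappaIs-functional κv (r i) = κw

  rep𝟙-sameRep : ∀ {k} {W : Fin k → Fin N} {v w} → Rep𝟙 W v → Rep𝟙 W w → SameRep G W v w
  rep𝟙-sameRep rv rw i = fin 1 , rv i , rw i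

  sameRep? : ∀ {k} (W : Fin k → Fin N) v w → Dec (SameRep G W v w)
  sameRep? W v w = Finₚ.all? λ i → let x , κv = kappa v (W i) in
    map′ (λ κw → x , κv , κw)
         (λ (y , κv′ , κw) → subst (KappaIs G w (W i)) (sym (KappaIs-functional κv κv′)) κw)
         (kappaIs? w (W i) x)

  resolving? : ∀ {k} (W : Fin k → Fin N) → Dec (Resolving G W)
  resolving? W = Finₚ.all? λ v → Finₚ.all? λ w → sameRep? W v w →-dec (v ≟ w)

  injective? : ∀ {k} (W : Fin k → Fin N) → Dec (Injective _≡_ _≡_ W)
  injective? W = map′ (λ inj {i} {j} → inj i j) (λ inj i j → inj)
                      (Finₚ.all? λ i → Finₚ.all? λ j → (W i ≟ W j) →-dec (i ≟ j))

  rep𝟙? : ∀ {k} (W : Fin k → Fin N) → Dec (∃ (Rep𝟙 W))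
  rep𝟙? W = Finₚ.any? λ v → Finₚ.all? λ i → kappaIs? v (W i) (fin 1)

  -- All bases have the size of B, so a basis without 𝟙 representation can be sought by a finite search
  -- among the tuples of that size.
  basis-without-rep𝟙 : ∀ {d} {B : Fin d → Fin N} → IsBasis G B → ¬ Forces𝟙 G →
                       Σ (Fin d → Fin N) λ B′ → IsBasis G B′ × ¬ ∃ (Rep𝟙 B′)
  basis-without-rep𝟙 {d} {B} (B-inj , B-res , B-min) ¬forces
    with ∃?-function Candidate resp (λ B′ → injective? B′ ×-dec resolving? B′ ×-dec ¬? (rep𝟙? B′))
    where
    Candidate : (Fin d → Fin N) → Set
    Candidate B′ = Injective _≡_ _≡_ B′ × Resolving G B′ × ¬ ∃ (Rep𝟙 B′)
    resp : ∀ {f g} → (∀ i → f i ≡ g i) → Candidate f → Candidate g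
    resp f≗g (f-inj , f-res , ¬rep𝟙) =
      (λ {i} {j} eq → f-inj (trans (f≗g i) (trans eq (sym (f≗g j))))) ,
      resolving-⊆ (λ i → i , f≗g i) f-res ,
      λ (v , r) → ¬rep𝟙 (v , λ i → subst (λ x → KappaIs G v x (fin 1)) (sym (f≗g i)) (r i))
  ... | yes (B′ , B′-inj , B′-res , ¬rep𝟙) = B′ , (B′-inj , B′-res , B-min) , ¬rep𝟙
  ... | no ¬candidate = contradiction forces ¬forces
    where
    forces : Forces𝟙 G
    forces k B′ (B′-inj , B′-res , B′-min)
      with refl ← ≤-antisym (B′-min d B B-inj B-res) (B-min k B′ B′-inj B′-res)
      with rep𝟙? B′
    ... | yes r   = r
    ... | no ¬rep𝟙 = ⊥-elim (¬candidate (B′ , B′-inj , B′-res , ¬rep𝟙))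

lower : ∀ {m n} (W : Fin m → Fin (suc n)) → (∀ i → zero ≢ W i) → Fin m → Fin n
lower W W≢0 i = punchOut (W≢0 i)

suc-lower : ∀ {m n} {W : Fin m → Fin (suc n)} (W≢0 : ∀ i → zero ≢ W i) i →
            suc (lower W W≢0 i) ≡ W i
suc-lower W≢0 i = punchIn-punchOut (W≢0 i)

lower-injective : ∀ {m n} {W : Fin m → Fin (suc n)} (W≢0 : ∀ i → zero ≢ W i) →
                  Injective _≡_ _≡_ W → Injective _≡_ _≡_ (lower W W≢0)
lower-injective W≢0 W-inj = W-inj ∘ punchOut-injective (W≢0 _) (W≢0 _)

≟-true : ∀ {n} {x y : Fin n} → ⌊ x ≟ y ⌋ ≡ true → x ≡ y
≟-true e = toWitness (subst T (sym e) tt)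

module Leaf {n : ℕ} (G : Graph n) (u : Fin n) where

  open Paths
  open Representations

  G′ : Graph (suc n)
  G′ = addLeaf G u

  chain-lift : ∀ {x y p} → Chain G x y p → Chain G′ (suc x) (suc y) (map suc p)
  chain-lift (single _) = single _
  chain-lift (step e c) = step e (chain-lift c)

  path-lift : ∀ {x y p} → IsPath G x y p → IsPath G′ (suc x) (suc y) (map suc p)
  path-lift (c , p!) = chain-lift c , Uniqueₚ.map⁺ suc-injective p!

  -- A path could only enter and leave the leaf through u, visiting u twice.
  chain-lower : ∀ {x y p} → Chain G′ (suc x) (suc y) p → Unique p →
                ∃ λ q → Chain G x y q × p ≡ map suc q
  chain-lower (single _) _ = _ , single _ , refl
  chain-lower (step {x = zero} _ (step {x = zero} () _)) _
  chain-lower {x} (step {x = zero} e (step {x = suc z} e′ c)) (x∉p ∷ _)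
    with refl ← ≟-true {x = x} e | refl ← ≟-true {x = z} e′ =
    contradiction refl (All.lookup x∉p (there (chain-first G′ c)))
  chain-lower (step {x = suc _} e c) (_ ∷ p!) with q , cq , refl ← chain-lower c p! =
    _ , step e cq , refl

  path-lower : ∀ {x y p} → IsPath G′ (suc x) (suc y) p → ∃ λ q → IsPath G x y q × p ≡ map suc q
  path-lower (c , p!) with q , cq , refl ← chain-lower c p! = q , (cq , Uniqueₚ.map⁻ p!) , refl

  paths-lower : ∀ {x y ps} → All (IsPath G′ (suc x) (suc y)) ps →
                ∃ λ qs → All (IsPath G x y) qs × ps ≡ map (map suc) qs
  paths-lower []         = [] , [] , refl
  paths-lower (π ∷ πs) with q , πq , refl ← path-lower π | qs , πqs , refl ← paths-lower πs =
    q ∷ qs , πq ∷ πqs , refl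

  intDisjoint-lift : ∀ {x y p q} → IntDisjoint G x y p q →
                     IntDisjoint G′ (suc x) (suc y) (map suc p) (map suc q)
  intDisjoint-lift {x} {y} {p} {q} (p≢q , shared) = p≢q ∘ map-injective suc-injective , shared′
    where
    shared′ : ∀ z → z ∈ map suc p → z ∈ map suc q → z ≡ suc x ⊎ z ≡ suc y
    shared′ z z∈p z∈q with a , a∈p , refl ← ∈-map⁻ suc z∈p | _ , a∈q , refl ← ∈-map⁻ suc z∈q =
      Sum.map (cong suc) (cong suc) (shared a a∈p a∈q)

  intDisjoint-lower : ∀ {x y p q} → IntDisjoint G′ (suc x) (suc y) (map suc p) (map suc q) →
                      IntDisjoint G x y p q
  intDisjoint-lower (p≢q , shared) = p≢q ∘ cong (map suc) , λ z z∈p z∈q →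
    Sum.map suc-injective suc-injective (shared (suc z) (∈-map⁺ suc z∈p) (∈-map⁺ suc z∈q))

  family-lift : ∀ {x y m} → DisjointFamily G x y m → DisjointFamily G′ (suc x) (suc y) m
  family-lift (ps , len , ps-paths , disjoint) =
    map (map suc) ps , trans (length-map _ ps) len ,
    Allₚ.map⁺ (All.map path-lift ps-paths) , AllPairsₚ.map⁺ (AllPairs.map intDisjoint-lift disjoint)

  family-lower : ∀ {x y m} → DisjointFamily G′ (suc x) (suc y) m → DisjointFamily G x y m
  family-lower (ps , len , ps-paths , disjoint) with qs , qs-paths , refl ← paths-lower ps-paths =
    qs , trans (sym (length-map _ qs)) len , qs-paths ,
    AllPairs.map intDisjoint-lower (AllPairsₚ.map⁻ disjoint)

  kappa-lift : ∀ {x y k} → KappaIs G x y k → KappaIs G′ (suc x) (suc y) k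
  kappa-lift (κ∞ refl) = κ∞ refl
  kappa-lift (κfin (x≢y , family , maximal)) =
    κfin (x≢y ∘ suc-injective , family-lift family , λ m → maximal m ∘ family-lower)

  kappa-lower : ∀ {x y k} → KappaIs G′ (suc x) (suc y) k → KappaIs G x y k
  kappa-lower (κ∞ refl) = κ∞ refl
  kappa-lower (κfin (x≢y , family , maximal)) =
    κfin (x≢y ∘ cong suc , family-lower family , λ m → maximal m ∘ family-lift)

  sameRep-lift : ∀ {k} {V : Fin k → Fin n} {v w} →
                 SameRep G V v w → SameRep G′ (suc ∘ V) (suc v) (suc w)
  sameRep-lift s i = let x , κv , κw = s i in x , kappa-lift κv , kappa-lift κw

  sameRep-lower : ∀ {k} {V : Fin k → Fin n} {v w} →
                  SameRep G′ (suc ∘ V) (suc v) (suc w) → SameRep G V v w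
  sameRep-lower s i = let x , κv , κw = s i in x , kappa-lower κv , kappa-lower κw

  leaf-adjacent : adj G′ zero (suc u) ≡ true
  leaf-adjacent = trans (isYes≗does (u ≟ u)) (dec-true (u ≟ u) refl)

  leaf-chain : ∀ {y p} → Chain G′ zero (suc y) p →
               ∃ λ r → p ≡ zero ∷ suc u ∷ r × Chain G′ (suc u) (suc y) (suc u ∷ r)
  leaf-chain (step {x = zero} () _)
  leaf-chain (step {x = suc _} {p = []} _ ())
  leaf-chain (step {x = suc z} {p = _ ∷ r} e c) with refl ← ≟-true {x = z} e | refl ← chain-head G′ c =
    r , refl , c

  -- Both paths pass through u, which must therefore be their common endpoint; then both are [ ℓ , u ].
  leaf-paths-meet : ∀ {y p q} → IsPath G′ zero (suc y) p → IsPath G′ zero (suc y) q →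
                    ¬ IntDisjoint G′ zero (suc y) p q
  leaf-paths-meet (cp , p!) (cq , q!) (p≢q , shared)
    with r , refl , cr ← leaf-chain cp | s , refl , cs ← leaf-chain cq
    with shared (suc u) (there (here refl)) (there (here refl))
  ... | inj₂ refl
    with refl ← loop-trivial G′ (cr , AllPairs.tail p!) | refl ← loop-trivial G′ (cs , AllPairs.tail q!) =
    p≢q refl

  leaf-kappa : Connected G → ∀ y → KappaIs G′ zero (suc y) (fin 1)
  leaf-kappa connected y with p , c , p! ← connected u y = κfin ((λ ()) , one-path , at-most-one)
    where
    leaf∉p : All (zero ≢_) (map suc p)
    leaf∉p = Allₚ.map⁺ (All.universal (λ _ ()) p)
    one-path : DisjointFamily G′ zero (suc y) 1
    one-path = [ zero ∷ map suc p ] , refl ,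
               (step leaf-adjacent (chain-lift c) , leaf∉p ∷ Uniqueₚ.map⁺ suc-injective p!) ∷ [] ,
               [] ∷ []
    at-most-one : ∀ m → DisjointFamily G′ zero (suc y) m → m ≤ 1
    at-most-one _ ([]     , refl , _) = z≤n
    at-most-one _ (_ ∷ [] , refl , _) = s≤s z≤n
    at-most-one _ (_ ∷ _ ∷ _ , refl , π₁ ∷ π₂ ∷ _ , (disjoint ∷ _) ∷ _) =
      contradiction disjoint (leaf-paths-meet π₁ π₂)

  withLeaf : ∀ {k} → (Fin k → Fin n) → Fin (suc k) → Fin (suc n)
  withLeaf V zero    = zero
  withLeaf V (suc i) = suc (V i)

  withLeaf-injective : ∀ {k} {V : Fin k → Fin n} → Injective _≡_ _≡_ V → Injective _≡_ _≡_ (withLeaf V)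
  withLeaf-injective V-inj {zero}  {zero}  _  = refl
  withLeaf-injective V-inj {suc i} {suc j} eq = cong suc (V-inj (suc-injective eq))

  module _ (connected : Connected G) where

    leaf-rep𝟙 : ∀ {k} (V : Fin k → Fin n) → Rep𝟙 G′ (suc ∘ V) zero
    leaf-rep𝟙 V = leaf-kappa connected ∘ V

    resolving-withLeaf⁺ : ∀ {k} {V : Fin k → Fin n} → Resolving G V → Resolving G′ (withLeaf V)
    resolving-withLeaf⁺ V-res zero    w       s = sameRep-member G′ zero s
    resolving-withLeaf⁺ V-res (suc v) zero    s = sym (sameRep-member G′ zero (sameRep-sym G′ s))
    resolving-withLeaf⁺ V-res (suc v) (suc w) s = cong suc (V-res v w (sameRep-lower (s ∘ suc)))

    resolving-withLeaf⁻ : ∀ {k} {V : Fin k → Fin n} → Resolving G′ (withLeaf V) → Resolving G V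
    resolving-withLeaf⁻ W-res v w s = suc-injective (W-res (suc v) (suc w) λ
      { zero    → fin 1 , kappa-sym G′ (leaf-kappa connected v) , kappa-sym G′ (leaf-kappa connected w)
      ; (suc i) → sameRep-lift s i })

    resolving-suc⁺ : ∀ {k} {V : Fin k → Fin n} → Resolving G V → ¬ ∃ (Rep𝟙 G V) → Resolving G′ (suc ∘ V)
    resolving-suc⁺         V-res ¬rep𝟙 zero    zero    s = refl
    resolving-suc⁺ {V = V} V-res ¬rep𝟙 zero    (suc w) s =
      ⊥-elim (¬rep𝟙 (w , kappa-lower ∘ sameRep-rep𝟙 G′ s (leaf-rep𝟙 V)))
    resolving-suc⁺         V-res ¬rep𝟙 (suc v) zero    s =
      sym (resolving-suc⁺ V-res ¬rep𝟙 zero (suc v) (sameRep-sym G′ s))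
    resolving-suc⁺         V-res ¬rep𝟙 (suc v) (suc w) s = cong suc (V-res v w (sameRep-lower s))

    resolving-suc⁻ : ∀ {k} {V : Fin k → Fin n} →
                     Resolving G′ (suc ∘ V) → Resolving G V × ¬ ∃ (Rep𝟙 G V)
    resolving-suc⁻ {V = V} W-res =
      resolving-withLeaf⁻ (resolving-⊆ G′ (λ i → suc i , refl) W-res) ,
      λ (v , r) → case W-res zero (suc v) (rep𝟙-sameRep G′ (leaf-rep𝟙 V) (kappa-lift ∘ r)) of λ ()

    data Restriction : ℕ → Set where
      leaf∈ : ∀ {m} (V : Fin m → Fin n) → Injective _≡_ _≡_ V → Resolving G V → Restriction (suc m)
      leaf∉ : ∀ {m} (V : Fin m → Fin n) → Injective _≡_ _≡_ V → Resolving G V → ¬ ∃ (Rep𝟙 G V) →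
              Restriction m

    restrict : ∀ {m} (W : Fin m → Fin (suc n)) → Injective _≡_ _≡_ W → Resolving G′ W → Restriction m
    restrict {m} W W-inj W-res with Finₚ.any? (λ j → W j ≟ zero)
    ... | no leaf∉W = let V-res , ¬rep𝟙 = resolving-suc⁻ (resolving-⊆ G′ W⊆sucV W-res) in
                      leaf∉ V (lower-injective W≢0 W-inj) V-res ¬rep𝟙
      where
      W≢0 : ∀ i → zero ≢ W i
      W≢0 i 0≡Wi = leaf∉W (i , sym 0≡Wi)
      V : Fin m → Fin n
      V = lower W W≢0
      W⊆sucV : W ⊆ (suc ∘ V)
      W⊆sucV i = i , sym (suc-lower W≢0 i)
    restrict {suc m} W W-inj W-res | yes (j , Wj≡0) =
      leaf∈ V (lower-injective W′≢0 (punchIn-injective j _ _ ∘ W-inj))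
            (resolving-withLeaf⁻ (resolving-⊆ G′ W⊆withLeafV W-res))
      where
      W′≢0 : ∀ i → zero ≢ W (punchIn j i)
      W′≢0 i 0≡Wi = punchInᵢ≢i j i (W-inj (trans (sym 0≡Wi) (sym Wj≡0)))
      V : Fin m → Fin n
      V = lower (W ∘ punchIn j) W′≢0
      W⊆withLeafV : W ⊆ withLeaf V
      W⊆withLeafV i with j ≟ i
      ... | yes refl = zero , Wj≡0
      ... | no j≢i  = suc (punchOut j≢i) ,
                      sym (trans (suc-lower W′≢0 (punchOut j≢i)) (cong W (punchIn-punchOut j≢i)))

    lowerBound : ∀ {d} → ResolvingLowerBound G d → ResolvingLowerBound G′ d
    lowerBound d≤ m W W-inj W-res with restrict W W-inj W-res
    ... | leaf∈ V V-inj V-res   = m≤n⇒m≤1+n (d≤ _ V V-inj V-res)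
    ... | leaf∉ V V-inj V-res _ = d≤ m V V-inj V-res

    lowerBound-forces𝟙 : ∀ {d} → Forces𝟙 G → ResolvingLowerBound G d → ResolvingLowerBound G′ (suc d)
    lowerBound-forces𝟙 forces d≤ m W W-inj W-res with restrict W W-inj W-res
    ... | leaf∈ V V-inj V-res = s≤s (d≤ _ V V-inj V-res)
    ... | leaf∉ V V-inj V-res ¬rep𝟙 with m≤n⇒m<n∨m≡n (d≤ m V V-inj V-res)
    ...   | inj₁ d<m  = d<m
    ...   | inj₂ refl = contradiction (forces m V (V-inj , V-res , d≤)) ¬rep𝟙

    basis-withLeaf : ∀ {d} {B : Fin d → Fin n} → Forces𝟙 G → IsBasis G B → IsBasis G′ (withLeaf B)
    basis-withLeaf forces (B-inj , B-res , B-min) =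
      withLeaf-injective B-inj , resolving-withLeaf⁺ B-res , lowerBound-forces𝟙 forces B-min

    basis-suc : ∀ {d} {B : Fin d → Fin n} → IsBasis G B → ¬ ∃ (Rep𝟙 G B) → IsBasis G′ (suc ∘ B)
    basis-suc (B-inj , B-res , B-min) ¬rep𝟙 =
      (λ eq → B-inj (suc-injective eq)) , resolving-suc⁺ B-res ¬rep𝟙 , lowerBound B-min

corollary3p5 : (n : ℕ) (G : Graph (suc n)) → Connected G → (u : Fin (suc n)) →
    (d : ℕ) → IsCdim G d →
    (Forces𝟙 G → IsCdim (addLeaf G u) (suc d)) × (¬ Forces𝟙 G → IsCdim (addLeaf G u) d)
corollary3p5 n G connected u d (B , B-basis) = forced , unforced
  where
  open Leaf G u
  forced : Forces𝟙 G → IsCdim G′ (suc d)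
  forced forces = withLeaf B , basis-withLeaf connected forces B-basis
  unforced : ¬ Forces𝟙 G → IsCdim G′ d
  unforced ¬forces =
    let B′ , B′-basis , ¬rep𝟙 = Representations.basis-without-rep𝟙 G B-basis ¬forces
    in  suc ∘ B′ , basis-suc connected B′-basis ¬rep𝟙
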